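{- Let $n \ge 2$ and let $P = v_1v_2\ldots v_n$ be a path on $n$ vertices, rooted at $v_k$ for some $k \in [n]$. Then $P$ (with root $v_k$) is a double-rooted local amoeba if and only if either $n$ is even, or $n$ is odd and $k \neq \frac{n+1}{2}$.
   Context: All graphs are finite and simple; $[n]=\{1,\dots,n\}$ and $S_n$ is the symmetric group on $[n]$. For a graph $G$ on vertex set $V=\{v_1,\dots,v_n\}$ (viewed as a spanning subgraph of the complete graph $K_n$ on $V$) and $\sigma\in S_n$, let $G_\sigma$ be the graph on $V$ with edge set $\{v_{\sigma^{ -1}(i)}v_{\sigma^{ -1}(j)} : v_iv_j\in E(G)\}$. Let $A_G=\{\sigma\in S_n : G_\sigma=G\}$. An edge-replacement $v_rv_s\to v_kv_l$ with $v_rv_s\in E(G)$, $v_kv_l\notin E(G)$ is feasible if $G-v_rv_s+v_kv_l\cong G$; for it let $S_G(rs\to kl)=\{\sigma\in S_n : G_\sigma=G-v_rv_s+v_kv_l\}$. Let $\mathcal{E}_G$ be the union of $A_G$ with all sets $S_G(rs\to kl)$ over feasible edge-replacements, and let $S_G$ be the subgroup of $S_n$ generated by $\mathcal{E}_G$. $G$ is a local amoeba if $S_G=S_n$. For $k\in[n]$, ${\rm Stab}_{S_G}(k)=\{\sigma\in S_G:\sigma(k)=k\}$. A graph $G$ rooted at $v_k$ is stem-transitive if there is a set $S\subseteq {\rm Stab}_{S_G}(k)$ such that the group generated by $S$ acts transitively on $[n]\setminus\{k\}$. A vertex $v_j$, $j\ne k$, is root-similar if there is $\varphi\in A_G$ with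 $\varphi(k)=j$. A rooted graph $G$ with minimum degree $\delta(G)=1$ that is stem-transitive and has a root-similar vertex is called a double-rooted global amoeba; if moreover $G$ is a local amoeba, it is called a double-rooted local amoeba. -}

module Defs where

open import Data.Nat using (ℕ; zero; suc; _+_; _≥_)
open import Data.Nat.DivMod using (_%_)
open import Data.Fin using (Fin; toℕ) renaming (_≟_ to _≟ᶠ_)
open import Data.Fin.Permutation using (Permutation′; _⟨$⟩ʳ_; id; _∘ₚ_; flip)
open import Data.Bool using (Bool; true; false; if_then_else_; _∧_; _∨_)
open import Data.List using (List; map; allFin)
open import Data.Nat.ListAction using (sum)
open import Data.Product using (Σ; ∃; _×_; _,_)
open import Data.Sum using (_⊎_)
open import Relation.Nullary using (¬_)
open import Relation.Nullary.Decidable using (⌊_⌋)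
open import Relation.Binary.PropositionalEquality using (_≡_; _≢_)
import Data.Nat as ℕ

-- A graph on vertex set {v_1,…,v_n}, encoded with vertex v_{i+1} ↦ (i : Fin n),
-- given by its (Boolean) adjacency function.
Graph : ℕ → Set
Graph n = Fin n → Fin n → Bool

_≐_ : ∀ {n} → Graph n → Graph n → Set
G ≐ H = ∀ x y → G x y ≡ H x y

-- G_σ : x y adjacent in G_σ iff σ(x) σ(y) adjacent in G
-- (edge set {v_{σ⁻¹(i)} v_{σ⁻¹(j)} : v_i v_j ∈ E(G)}).
act : ∀ {n} → Graph n → Permutation′ n → Graph n
act G σ x y = G (σ ⟨$⟩ʳ x) (σ ⟨$⟩ʳ y)

_≅_ : ∀ {n} → Graph n → Graph n → Set
H ≅ G = Σ (Permutation′ _) λ π → H ≐ act G π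

samePair : ∀ {n} → Fin n → Fin n → Fin n → Fin n → Bool
samePair x y r s = (⌊ x ≟ᶠ r ⌋ ∧ ⌊ y ≟ᶠ s ⌋) ∨ (⌊ x ≟ᶠ s ⌋ ∧ ⌊ y ≟ᶠ r ⌋)

replace : ∀ {n} → Graph n → Fin n → Fin n → Fin n → Fin n → Graph n
replace G r s k l x y =
  if samePair x y r s then false else (if samePair x y k l then true else G x y)

Feasible : ∀ {n} → Graph n → Fin n → Fin n → Fin n → Fin n → Set
Feasible G r s k l = G r s ≡ true × G k l ≡ false × k ≢ l × (replace G r s k l ≅ G)

Aut : ∀ {n} → Graph n → Permutation′ n → Set
Aut G σ = act G σ ≐ G

SRepl : ∀ {n} → Graph n → Fin n → Fin n → Fin n → Fin n → Permutation′ n → Set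
SRepl G r s k l σ = act G σ ≐ replace G r s k l

ℰ : ∀ {n} → Graph n → Permutation′ n → Set
ℰ G σ = Aut G σ ⊎ ∃ λ r → ∃ λ s → ∃ λ k → ∃ λ l → Feasible G r s k l × SRepl G r s k l σ

data Gen {n} (P : Permutation′ n → Set) : Permutation′ n → Set where
  gen  : ∀ {σ} → P σ → Gen P σ
  one  : Gen P id
  comp : ∀ {σ τ} → Gen P σ → Gen P τ → Gen P (σ ∘ₚ τ)
  inv  : ∀ {σ} → Gen P σ → Gen P (flip σ)
  ext  : ∀ {σ τ} → (∀ i → σ ⟨$⟩ʳ i ≡ τ ⟨$⟩ʳ i) → Gen P σ → Gen P τ

SG : ∀ {n} → Graph n → Permutation′ n → Set
SG G = Gen (ℰ G)

LocalAmoeba : ∀ {n} → Graph n → Set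
LocalAmoeba G = ∀ σ → SG G σ

deg : ∀ {n} → Graph n → Fin n → ℕ
deg {n} G x = sum (map (λ y → if G x y then 1 else 0) (allFin n))

MinDegreeOne : ∀ {n} → Graph n → Set
MinDegreeOne G = (∀ x → deg G x ≥ 1) × ∃ λ x → deg G x ≡ 1

StemTransitive : ∀ {n} → Graph n → Fin n → Set₁
StemTransitive {n} G k =
  Σ (Permutation′ n → Set) λ S →
    (∀ σ → S σ → SG G σ × σ ⟨$⟩ʳ k ≡ k) ×
    (∀ i j → i ≢ k → j ≢ k → ∃ λ τ → Gen S τ × τ ⟨$⟩ʳ i ≡ j)

RootSimilar : ∀ {n} → Graph n → Fin n → Fin n → Set
RootSimilar G k j = j ≢ k × ∃ λ φ → Aut G φ × φ ⟨$⟩ʳ k ≡ j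

DoubleRootedGlobalAmoeba : ∀ {n} → Graph n → Fin n → Set₁
DoubleRootedGlobalAmoeba G k =
  MinDegreeOne G × StemTransitive G k × ∃ λ j → RootSimilar G k j

DoubleRootedLocalAmoeba : ∀ {n} → Graph n → Fin n → Set₁
DoubleRootedLocalAmoeba G k = DoubleRootedGlobalAmoeba G k × LocalAmoeba G

path : (n : ℕ) → Graph n
path n x y = ⌊ suc (toℕ x) ℕ.≟ toℕ y ⌋ ∨ ⌊ suc (toℕ y) ℕ.≟ toℕ x ⌋

{-# OPTIONS --safe #-}
module Submission where

-- Number the vertices 0, …, n-1 and let ρₘ reverse the prefix 0, …, m-1.  For m = n, ρₘ is an
-- automorphism of the path; for 2 ≤ m < n it maps the path onto the path with the edge {m-1, m}
-- replaced by {0, m}, so ρₘ ∈ S_G in either case.  Conjugating ρ₂ = (0 1) by ρ_{j+1} gives the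
-- adjacent transposition (j-1 j), and adjacent transpositions generate Sₙ: the path is a local
-- amoeba, and the stabiliser of the root in S_G = Sₙ is transitive on the other vertices.
-- Conversely, an automorphism of the path keeps the direction of its first step all along the
-- path (by injectivity), so it is the identity or the reversal.  Both fix the middle vertex,
-- which exists exactly when n is odd; at any other root the reversal yields a root-similar vertex.

open import Defs
open import Data.Nat using (ℕ; zero; suc; _+_; _*_; _∸_; _≤_; _<_; _≥_; z≤n; s≤s)
open import Data.Nat.Properties
open import Data.Nat.DivMod using (_%_; m%n<n; m*n%n≡0; %-distribˡ-+)
import Data.Fin as Fin
open import Data.Fin using (Fin; toℕ; fromℕ<; opposite) renaming (_≟_ to _≟ᶠ_)
open import Data.Fin.Properties using (toℕ-injective; toℕ<n; toℕ-fromℕ<; toℕ-fromℕ; toℕ-inject₁; opposite-prop)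
  renaming (suc-injective to suc-injectiveᶠ)
open import Data.Fin.Permutation
  using (Permutation′; permutation; _⟨$⟩ʳ_; _⟨$⟩ˡ_; id; _∘ₚ_; flip; transpose; inverseˡ; inverseʳ)
open import Data.Fin.Permutation.Transposition.List using (TranspositionList; eval; decompose; eval-decompose)
open import Data.List using ([]; _∷_; tabulate)
open import Data.List.Properties using (map-tabulate)
open import Data.Nat.ListAction using (sum)
open import Data.Product using (∃; _×_; _,_; proj₂)
open import Data.Sum using (_⊎_; inj₁; inj₂; swap)
open import Function.Base using (_∘_)
open import Function.Bundles using (_⇔_; mk⇔; Equivalence; Injection)
open import Function.Properties.Inverse using (↔⇒↣)
open import Relation.Nullary using (¬_; yes; no; contradiction)
open import Relation.Nullary.Decidable using (Dec; does; isYes; _×-dec_; _⊎-dec_; dec-true; dec-false; isYes≗does; does-⇔)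
open import Data.Bool using (true; false; _∧_; _∨_; if_then_else_)
open import Data.Bool.Properties using (∨-comm)
open import Relation.Binary.PropositionalEquality
open import Relation.Binary.Definitions using (tri<; tri≈; tri>)

predecessor : ∀ {n} {x : Fin n} {i} → toℕ x ≡ suc i → ∃ λ w → toℕ w ≡ i × suc (toℕ w) ≡ toℕ x
predecessor {n} {x} {i} x≡i+1 = fromℕ< i<n , toℕ-fromℕ< i<n , trans (cong suc (toℕ-fromℕ< i<n)) (sym x≡i+1)
  where
  i<n : i < n
  i<n = <-trans (≤-reflexive (sym x≡i+1)) (toℕ<n x)

module _ {n : ℕ} where

  transpose-matchˡ : (i j : Fin n) → transpose i j ⟨$⟩ʳ i ≡ j
  transpose-matchˡ i j rewrite dec-true (i ≟ᶠ i) refl = refl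

  transpose-matchʳ : (i j : Fin n) → transpose i j ⟨$⟩ʳ j ≡ i
  transpose-matchʳ i j with j ≟ᶠ i
  ... | yes j≡i = j≡i
  ... | no _ rewrite dec-true (j ≟ᶠ j) refl = refl

  transpose-fixes : {i j k : Fin n} → k ≢ i → k ≢ j → transpose i j ⟨$⟩ʳ k ≡ k
  transpose-fixes {i} {j} {k} k≢i k≢j rewrite dec-false (k ≟ᶠ i) k≢i | dec-false (k ≟ᶠ j) k≢j = refl

  transpose-unique : (σ : Permutation′ n) {i j : Fin n} →
    σ ⟨$⟩ʳ i ≡ j → σ ⟨$⟩ʳ j ≡ i → (∀ k → k ≢ i → k ≢ j → σ ⟨$⟩ʳ k ≡ k) →
    ∀ k → σ ⟨$⟩ʳ k ≡ transpose i j ⟨$⟩ʳ k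
  transpose-unique σ {i} {j} σi σj σk k with k ≟ᶠ i
  ... | yes refl = σi
  ... | no k≢i with k ≟ᶠ j
  ...   | yes refl = σj
  ...   | no k≢j = σk k k≢i k≢j

module _ {n : ℕ} {P : Permutation′ n → Set} where

  Gen-transpose-refl : (i : Fin n) → Gen P (transpose i i)
  Gen-transpose-refl i = ext (transpose-unique id refl refl (λ _ _ _ → refl)) one

  Gen-transpose-sym : {i j : Fin n} → Gen P (transpose i j) → Gen P (transpose j i)
  Gen-transpose-sym {i} {j} =
    ext (transpose-unique (transpose i j) (transpose-matchʳ i j) (transpose-matchˡ i j)
                          (λ k k≢j k≢i → transpose-fixes k≢i k≢j))

  Gen-transpose-conj : {σ : Permutation′ n} {i j : Fin n} → Gen P σ → Gen P (transpose i j) →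
    Gen P (transpose (σ ⟨$⟩ʳ i) (σ ⟨$⟩ʳ j))
  Gen-transpose-conj {σ} {i} {j} σ∈ τ∈ =
    ext (transpose-unique conjugate (conjugate-maps (transpose-matchˡ i j)) (conjugate-maps (transpose-matchʳ i j)) conjugate-fixes)
        (comp (comp (inv σ∈) τ∈) σ∈)
    where
    conjugate : Permutation′ n
    conjugate = (flip σ ∘ₚ transpose i j) ∘ₚ σ
    conjugate-maps : ∀ {u v} → transpose i j ⟨$⟩ʳ u ≡ v → conjugate ⟨$⟩ʳ (σ ⟨$⟩ʳ u) ≡ σ ⟨$⟩ʳ v
    conjugate-maps eq = cong (σ ⟨$⟩ʳ_) (trans (cong (transpose i j ⟨$⟩ʳ_) (inverseˡ σ)) eq)
    conjugate-fixes : ∀ k → k ≢ σ ⟨$⟩ʳ i → k ≢ σ ⟨$⟩ʳ j → conjugate ⟨$⟩ʳ k ≡ k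
    conjugate-fixes k k≢σi k≢σj = trans (cong (σ ⟨$⟩ʳ_) (transpose-fixes (unσ k≢σi) (unσ k≢σj))) (inverseʳ σ)
      where
      unσ : ∀ {u} → k ≢ σ ⟨$⟩ʳ u → σ ⟨$⟩ˡ k ≢ u
      unσ k≢σu refl = k≢σu (sym (inverseʳ σ))

  Gen-transpositions⇒all : (∀ i j → Gen P (transpose i j)) → ∀ π → Gen P π
  Gen-transpositions⇒all transpose∈ π = ext (eval-decompose π) (eval∈ (decompose π))
    where
    eval∈ : (τs : TranspositionList n) → Gen P (eval τs)
    eval∈ [] = one
    eval∈ ((i , j) ∷ τs) = comp (transpose∈ i j) (eval∈ τs)

  module _ (adjacent∈ : ∀ {i j} → suc (toℕ i) ≡ toℕ j → Gen P (transpose i j)) where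

    Gen-transpose-at-distance : ∀ d {i j} → suc (toℕ i) + d ≡ toℕ j → Gen P (transpose i j)
    Gen-transpose-at-distance zero i+0≡j = adjacent∈ (trans (sym (+-identityʳ _)) i+0≡j)
    Gen-transpose-at-distance (suc d) {i} {j} i+d+1≡j
      with w , w≡i+d , w+1≡j ← predecessor (trans (sym i+d+1≡j) (+-suc (suc (toℕ i)) d)) =
      subst₂ (λ u v → Gen P (transpose u v)) (transpose-fixes i≢w i≢j) (transpose-matchˡ w j)
        (Gen-transpose-conj (adjacent∈ w+1≡j) (Gen-transpose-at-distance d (sym w≡i+d)))
      where
      i≢w : i ≢ w
      i≢w i≡w = m≢1+m+n (toℕ i) (trans (cong toℕ i≡w) w≡i+d)
      i≢j : i ≢ j
      i≢j i≡j = m≢1+m+n (toℕ i) (trans (cong toℕ i≡j) (sym i+d+1≡j))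

    Gen-transpose-below : ∀ {i j} → toℕ i < toℕ j → Gen P (transpose i j)
    Gen-transpose-below i<j = let d , i+d≡j = m≤n⇒∃[o]m+o≡n i<j in Gen-transpose-at-distance d i+d≡j

    Gen-adjacent⇒transpositions : ∀ i j → Gen P (transpose i j)
    Gen-adjacent⇒transpositions i j with <-cmp (toℕ i) (toℕ j)
    ... | tri< i<j _ _ = Gen-transpose-below i<j
    ... | tri≈ _ i≡j _ = subst (λ v → Gen P (transpose i v)) (toℕ-injective i≡j) (Gen-transpose-refl i)
    ... | tri> _ _ j<i = Gen-transpose-sym (Gen-transpose-below j<i)

SamePair : {A : Set} → A → A → A → A → Set
SamePair x y r s = (x ≡ r × y ≡ s) ⊎ (x ≡ s × y ≡ r)

SamePair-swap : {A : Set} {x y r s : A} → SamePair x y r s → SamePair y x r s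
SamePair-swap (inj₁ (x≡r , y≡s)) = inj₂ (y≡s , x≡r)
SamePair-swap (inj₂ (x≡s , y≡r)) = inj₁ (y≡r , x≡s)

SamePair-toℕ : ∀ {n} {x y r s : Fin n} {a b} → toℕ r ≡ a → toℕ s ≡ b →
  SamePair (toℕ x) (toℕ y) a b → SamePair x y r s
SamePair-toℕ refl refl (inj₁ (x≡r , y≡s)) = inj₁ (toℕ-injective x≡r , toℕ-injective y≡s)
SamePair-toℕ refl refl (inj₂ (x≡s , y≡r)) = inj₂ (toℕ-injective x≡s , toℕ-injective y≡r)

module _ {n : ℕ} where

  samePair? : (x y r s : Fin n) → Dec (SamePair x y r s)
  samePair? x y r s = (x ≟ᶠ r ×-dec y ≟ᶠ s) ⊎-dec (x ≟ᶠ s ×-dec y ≟ᶠ r)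

  samePair≡does : (x y r s : Fin n) → samePair x y r s ≡ does (samePair? x y r s)
  samePair≡does x y r s = cong₂ _∨_ (cong₂ _∧_ (isYes≗does (x ≟ᶠ r)) (isYes≗does (y ≟ᶠ s)))
                                    (cong₂ _∧_ (isYes≗does (x ≟ᶠ s)) (isYes≗does (y ≟ᶠ r)))

  samePair-true : {x y r s : Fin n} → SamePair x y r s → samePair x y r s ≡ true
  samePair-true {x} {y} {r} {s} xy≡rs = trans (samePair≡does x y r s) (dec-true (samePair? x y r s) xy≡rs)

  samePair-false : {x y r s : Fin n} → ¬ SamePair x y r s → samePair x y r s ≡ false
  samePair-false {x} {y} {r} {s} xy≢rs = trans (samePair≡does x y r s) (dec-false (samePair? x y r s) xy≢rs)

  SamePair-symmetric-≡ : {H : Graph n} {x y u v : Fin n} → (∀ x y → H x y ≡ H y x) →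
    SamePair x y u v → H x y ≡ H u v
  SamePair-symmetric-≡ H-sym (inj₁ (refl , refl)) = refl
  SamePair-symmetric-≡ H-sym (inj₂ (refl , refl)) = H-sym _ _

  replace-unique : {G H : Graph n} {r s k l : Fin n} → (∀ x y → H x y ≡ H y x) →
    H r s ≡ false → H k l ≡ true →
    (∀ x y → ¬ SamePair x y r s → ¬ SamePair x y k l → H x y ≡ G x y) →
    replace G r s k l ≐ H
  replace-unique {G} {H} {r} {s} {k} {l} H-sym Hrs Hkl H≡G x y with samePair? x y r s
  ... | yes xy≡rs rewrite samePair-true xy≡rs = sym (trans (SamePair-symmetric-≡ H-sym xy≡rs) Hrs)
  ... | no xy≢rs rewrite samePair-false xy≢rs with samePair? x y k l
  ...   | yes xy≡kl rewrite samePair-true xy≡kl = sym (trans (SamePair-symmetric-≡ H-sym xy≡kl) Hkl)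
  ...   | no xy≢kl rewrite samePair-false xy≢kl = sym (H≡G x y xy≢rs xy≢kl)

  LocalAmoeba⇒StemTransitive : {G : Graph n} → LocalAmoeba G → (k : Fin n) → StemTransitive G k
  LocalAmoeba⇒StemTransitive {G} local k =
    (λ σ → SG G σ × σ ⟨$⟩ʳ k ≡ k) , (λ _ σ∈ → σ∈) ,
    λ i j i≢k j≢k → transpose i j ,
                    gen (local (transpose i j) , transpose-fixes (≢-sym i≢k) (≢-sym j≢k)) ,
                    transpose-matchˡ i j

sum-tabulate-≥ : ∀ {n} (g : Fin n → ℕ) y → g y ≤ sum (tabulate g)
sum-tabulate-≥ g Fin.zero = m≤m+n _ _
sum-tabulate-≥ g (Fin.suc y) = ≤-trans (sum-tabulate-≥ (g ∘ Fin.suc) y) (m≤n+m _ _)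

sum-tabulate-zero : ∀ {n} (g : Fin n → ℕ) → (∀ z → g z ≡ 0) → sum (tabulate g) ≡ 0
sum-tabulate-zero {zero} g g≡0 = refl
sum-tabulate-zero {suc n} g g≡0 = cong₂ _+_ (g≡0 Fin.zero) (sum-tabulate-zero (g ∘ Fin.suc) (g≡0 ∘ Fin.suc))

sum-tabulate-single : ∀ {n} (g : Fin n → ℕ) y → (∀ z → z ≢ y → g z ≡ 0) → sum (tabulate g) ≡ g y
sum-tabulate-single g Fin.zero g≡0 =
  trans (cong (g Fin.zero +_) (sum-tabulate-zero (g ∘ Fin.suc) (λ z → g≡0 (Fin.suc z) λ ()))) (+-identityʳ _)
sum-tabulate-single g (Fin.suc y) g≡0 = cong₂ _+_ (g≡0 Fin.zero λ ())
  (sum-tabulate-single (g ∘ Fin.suc) y (λ z z≢y → g≡0 (Fin.suc z) (z≢y ∘ suc-injectiveᶠ)))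

module _ {n : ℕ} (G : Graph n) (x : Fin n) where

  private
    indicator : Fin n → ℕ
    indicator y = if G x y then 1 else 0

  deg≡sum : deg G x ≡ sum (tabulate indicator)
  deg≡sum = cong sum (map-tabulate (λ y → y) indicator)

  neighbour⇒deg≥1 : ∀ {y} → G x y ≡ true → 1 ≤ deg G x
  neighbour⇒deg≥1 {y} edge = begin
    1                          ≡⟨ cong (λ b → if b then 1 else 0) edge ⟨
    indicator y                ≤⟨ sum-tabulate-≥ indicator y ⟩
    sum (tabulate indicator)   ≡⟨ deg≡sum ⟨
    deg G x                    ∎
    where open ≤-Reasoning

  unique-neighbour⇒deg≡1 : ∀ {y} → G x y ≡ true → (∀ z → G x z ≡ true → z ≡ y) → deg G x ≡ 1
  unique-neighbour⇒deg≡1 {y} edge unique = trans deg≡sum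
    (trans (sum-tabulate-single indicator y non-neighbour) (cong (λ b → if b then 1 else 0) edge))
    where
    non-neighbour : ∀ z → z ≢ y → indicator z ≡ 0
    non-neighbour z z≢y with G x z in edge-z
    ... | true = contradiction (unique z edge-z) z≢y
    ... | false = refl

Adjacent : ℕ → ℕ → Set
Adjacent a b = suc a ≡ b ⊎ suc b ≡ a

adjacent? : (a b : ℕ) → Dec (Adjacent a b)
adjacent? a b = suc a ≟ b ⊎-dec suc b ≟ a

successor-transfer : {x y a b : ℕ} → x + a ≡ y + b → suc x ≡ y ⇔ suc b ≡ a
successor-transfer {x} {y} {a} {b} x+a≡y+b = mk⇔
  (λ { refl → sym (+-cancelˡ-≡ x a (suc b) (trans x+a≡y+b (sym (+-suc x b)))) })
  (λ { refl → +-cancelʳ-≡ b (suc x) y (trans (sym (+-suc x b)) x+a≡y+b) })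

Adjacent-mirror : {x y a b : ℕ} → x + a ≡ y + b → Adjacent x y ⇔ Adjacent a b
Adjacent-mirror x+a≡y+b = mk⇔
  (λ { (inj₁ up) → inj₂ (to forward up) ; (inj₂ down) → inj₁ (to backward down) })
  (λ { (inj₁ up) → inj₂ (from backward up) ; (inj₂ down) → inj₁ (from forward down) })
  where
  open Equivalence
  forward = successor-transfer x+a≡y+b
  backward = successor-transfer (sym x+a≡y+b)

path≡does : ∀ {n} (x y : Fin n) → path n x y ≡ does (adjacent? (toℕ x) (toℕ y))
path≡does x y = cong₂ _∨_ (isYes≗does (suc (toℕ x) ≟ toℕ y)) (isYes≗does (suc (toℕ y) ≟ toℕ x))

path-at : ∀ {n} {x y : Fin n} {a b} → toℕ x ≡ a → toℕ y ≡ b → path n x y ≡ does (adjacent? a b)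
path-at {x = x} {y} refl refl = path≡does x y

path-sym : ∀ {n} (x y : Fin n) → path n x y ≡ path n y x
path-sym x y = ∨-comm (isYes (suc (toℕ x) ≟ toℕ y)) (isYes (suc (toℕ y) ≟ toℕ x))

path-adjacent : ∀ {n} {x y : Fin n} → path n x y ≡ true → Adjacent (toℕ x) (toℕ y)
path-adjacent {x = x} {y} edge with adjacent? (toℕ x) (toℕ y)
... | yes adj = adj
... | no ¬adj = contradiction (trans (sym edge) (trans (path≡does x y) (dec-false (adjacent? _ _) ¬adj))) λ ()

path-adjacent⁻¹ : ∀ {n} {x y : Fin n} → Adjacent (toℕ x) (toℕ y) → path n x y ≡ true
path-adjacent⁻¹ {x = x} {y} adj = trans (path≡does x y) (dec-true (adjacent? _ _) adj)

path-minDegreeOne : ∀ {n} → MinDegreeOne (path (suc (suc n)))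
path-minDegreeOne {n} = (λ x → neighbour⇒deg≥1 P x (proj₂ (neighbour x))) ,
  Fin.zero , unique-neighbour⇒deg≡1 P Fin.zero refl first-neighbour
  where
  P = path (suc (suc n))
  neighbour : (x : Fin (suc (suc n))) → ∃ λ y → P x y ≡ true
  neighbour Fin.zero = Fin.suc Fin.zero , refl
  neighbour (Fin.suc x) = Fin.inject₁ x , path-adjacent⁻¹ (inj₂ (cong suc (toℕ-inject₁ x)))
  first-neighbour : ∀ z → P Fin.zero z ≡ true → z ≡ Fin.suc Fin.zero
  first-neighbour z edge with path-adjacent {x = Fin.zero} {z} edge
  ... | inj₁ 1≡z = toℕ-injective (sym 1≡z)
  ... | inj₂ ()

-- Proofs split on m ≤? a rather than a <? m: a `with` on the latter would also abstract the
-- test inside reversePrefix.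
reversePrefix : ℕ → ℕ → ℕ
reversePrefix m a with a <? m
... | yes _ = m ∸ suc a
... | no _ = a

module _ {m : ℕ} where

  reversePrefix-< : ∀ {a} → a < m → reversePrefix m a ≡ m ∸ suc a
  reversePrefix-< {a} a<m with a <? m
  ... | yes _ = refl
  ... | no a≮m = contradiction a<m a≮m

  reversePrefix-≥ : ∀ {a} → m ≤ a → reversePrefix m a ≡ a
  reversePrefix-≥ {a} m≤a with a <? m
  ... | yes a<m = contradiction m≤a (<⇒≱ a<m)
  ... | no _ = refl

  reversePrefix-mirror : ∀ {a} → a < m → suc (reversePrefix m a + a) ≡ m
  reversePrefix-mirror {a} a<m = trans (sym (+-suc _ a))
    (trans (cong (_+ suc a) (reversePrefix-< a<m)) (m∸n+n≡m a<m))

  reversePrefix<m : ∀ {a} → a < m → reversePrefix m a < m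
  reversePrefix<m {a} a<m = ≤-trans (s≤s (m≤m+n _ a)) (≤-reflexive (reversePrefix-mirror a<m))

  reversePrefix-involutive : ∀ a → reversePrefix m (reversePrefix m a) ≡ a
  reversePrefix-involutive a with m ≤? a
  ... | yes m≤a = trans (cong (reversePrefix m) (reversePrefix-≥ m≤a)) (reversePrefix-≥ m≤a)
  ... | no m≰a = +-cancelʳ-≡ (reversePrefix m a) _ a (suc-injective
        (trans (reversePrefix-mirror (reversePrefix<m a<m))
               (trans (sym (reversePrefix-mirror a<m)) (cong suc (+-comm _ a)))))
    where a<m = ≰⇒> m≰a

  reversePrefix<n : ∀ {n a} → m ≤ n → a < n → reversePrefix m a < n
  reversePrefix<n {a = a} m≤n a<n with m ≤? a
  ... | yes m≤a = subst (_< _) (sym (reversePrefix-≥ m≤a)) a<n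
  ... | no m≰a = ≤-trans (reversePrefix<m (≰⇒> m≰a)) m≤n

  reversePrefix-adjacent-below : ∀ {a b} → a < m → b < m →
    Adjacent (reversePrefix m a) (reversePrefix m b) ⇔ Adjacent a b
  reversePrefix-adjacent-below a<m b<m =
    Adjacent-mirror (suc-injective (trans (reversePrefix-mirror a<m) (sym (reversePrefix-mirror b<m))))

  Adjacent-across : ∀ {a b} → a < m → m ≤ b → Adjacent a b → suc a ≡ m × b ≡ m
  Adjacent-across a<m m≤b (inj₁ refl) = ≤-antisym a<m m≤b , ≤-antisym a<m m≤b
  Adjacent-across {b = b} a<m m≤b (inj₂ refl) = contradiction (≤-trans (<⇒≤ a<m) m≤b) (n≮n b)

  Adjacent-reversePrefix-across : ∀ {a b} → a < m → m ≤ b → Adjacent (reversePrefix m a) b → a ≡ 0 × b ≡ m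
  Adjacent-reversePrefix-across {a} a<m m≤b (inj₁ refl) = a≡0 , b≡m
    where
    b≡m : suc (reversePrefix m a) ≡ m
    b≡m = ≤-antisym (reversePrefix<m a<m) m≤b
    a≡0 : a ≡ 0
    a≡0 = +-cancelˡ-≡ (reversePrefix m a) a 0
      (suc-injective (trans (reversePrefix-mirror a<m) (trans (sym b≡m) (cong suc (sym (+-identityʳ _))))))
  Adjacent-reversePrefix-across {b = b} a<m m≤b (inj₂ b+1≡a′) =
    contradiction (≤-trans (≤-reflexive b+1≡a′) (≤-trans (<⇒≤ (reversePrefix<m a<m)) m≤b)) (n≮n b)

module _ {c : ℕ} where

  private
    m = suc c
    ρ = reversePrefix m

  reversePrefix-adjacent-across : ∀ {a b} → a < m → m ≤ b →
    ¬ SamePair a b c m → ¬ SamePair a b 0 m → Adjacent (ρ a) (ρ b) ⇔ Adjacent a b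
  reversePrefix-adjacent-across {a} {b} a<m m≤b ab≢cm ab≢0m rewrite reversePrefix-≥ m≤b = mk⇔
    (λ adj → let a≡0 , b≡m = Adjacent-reversePrefix-across a<m m≤b adj in contradiction (inj₁ (a≡0 , b≡m)) ab≢0m)
    (λ adj → let a+1≡m , b≡m = Adjacent-across a<m m≤b adj in contradiction (inj₁ (suc-injective a+1≡m , b≡m)) ab≢cm)

  reversePrefix-adjacent : ∀ {a b} → ¬ SamePair a b c m → ¬ SamePair a b 0 m →
    Adjacent (ρ a) (ρ b) ⇔ Adjacent a b
  reversePrefix-adjacent {a} {b} ab≢cm ab≢0m with m ≤? a | m ≤? b
  ... | no m≰a | no m≰b = reversePrefix-adjacent-below (≰⇒> m≰a) (≰⇒> m≰b)
  ... | no m≰a | yes m≤b = reversePrefix-adjacent-across (≰⇒> m≰a) m≤b ab≢cm ab≢0m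
  ... | yes m≤a | no m≰b = mk⇔ (swap ∘ to across ∘ swap) (swap ∘ from across ∘ swap)
    where
    open Equivalence
    across = reversePrefix-adjacent-across (≰⇒> m≰b) m≤a (ab≢cm ∘ SamePair-swap) (ab≢0m ∘ SamePair-swap)
  ... | yes m≤a | yes m≤b rewrite reversePrefix-≥ m≤a | reversePrefix-≥ m≤b = mk⇔ (λ adj → adj) (λ adj → adj)

module _ {n m : ℕ} (m≤n : m ≤ n) where

  reversePrefixᶠ : Fin n → Fin n
  reversePrefixᶠ x = fromℕ< (reversePrefix<n m≤n (toℕ<n x))

  toℕ-reversePrefixᶠ : ∀ x → toℕ (reversePrefixᶠ x) ≡ reversePrefix m (toℕ x)
  toℕ-reversePrefixᶠ x = toℕ-fromℕ< _

  reversePrefixᶠ-involutive : ∀ x → reversePrefixᶠ (reversePrefixᶠ x) ≡ x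
  reversePrefixᶠ-involutive x = toℕ-injective (begin
    toℕ (reversePrefixᶠ (reversePrefixᶠ x))     ≡⟨ toℕ-reversePrefixᶠ (reversePrefixᶠ x) ⟩
    reversePrefix m (toℕ (reversePrefixᶠ x))    ≡⟨ cong (reversePrefix m) (toℕ-reversePrefixᶠ x) ⟩
    reversePrefix m (reversePrefix m (toℕ x))   ≡⟨ reversePrefix-involutive {m} (toℕ x) ⟩
    toℕ x                                       ∎)
    where open ≡-Reasoning

  prefixReversal : Permutation′ n
  prefixReversal = permutation reversePrefixᶠ reversePrefixᶠ reversePrefixᶠ-involutive reversePrefixᶠ-involutive

  act-path-prefixReversal : ∀ x y →
    act (path n) prefixReversal x y ≡ does (adjacent? (reversePrefix m (toℕ x)) (reversePrefix m (toℕ y)))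
  act-path-prefixReversal x y =
    trans (path≡does (reversePrefixᶠ x) (reversePrefixᶠ y)) (cong₂ (λ a b → does (adjacent? a b)) (toℕ-reversePrefixᶠ x) (toℕ-reversePrefixᶠ y))

prefixReversal-automorphism : ∀ {n} (n≤n : n ≤ n) → Aut (path n) (prefixReversal n≤n)
prefixReversal-automorphism n≤n x y = trans (act-path-prefixReversal n≤n x y)
  (trans (does-⇔ (reversePrefix-adjacent-below (toℕ<n x) (toℕ<n y)) (adjacent? _ _) (adjacent? _ _)) (sym (path≡does x y)))

-- In the paper's 1-based notation, ρ realises the edge-replacement v_m v_{m+1} → v_1 v_{m+1}.
module _ {n p : ℕ} (m<n : suc (suc p) < n) where

  private
    c = suc p
    m = suc c
    c<n : c < n
    c<n = <-trans (n<1+n c) m<n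
    0<n : 0 < n
    0<n = ≤-<-trans z≤n m<n
    vc vm v0 : Fin n
    vc = fromℕ< c<n
    vm = fromℕ< m<n
    v0 = fromℕ< 0<n
    toℕ-vc : toℕ vc ≡ c
    toℕ-vc = toℕ-fromℕ< c<n
    toℕ-vm : toℕ vm ≡ m
    toℕ-vm = toℕ-fromℕ< m<n
    toℕ-v0 : toℕ v0 ≡ 0
    toℕ-v0 = toℕ-fromℕ< 0<n
    ρ = prefixReversal (<⇒≤ m<n)

    toℕ-ρ : ∀ {v i} → toℕ v ≡ i → toℕ (ρ ⟨$⟩ʳ v) ≡ reversePrefix m i
    toℕ-ρ {v} v≡i = trans (toℕ-reversePrefixᶠ (<⇒≤ m<n) v) (cong (reversePrefix m) v≡i)

    ρ-vc : toℕ (ρ ⟨$⟩ʳ vc) ≡ 0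
    ρ-vc = trans (toℕ-ρ toℕ-vc) (trans (reversePrefix-< (n<1+n c)) (n∸n≡0 c))

    ρ-vm : toℕ (ρ ⟨$⟩ʳ vm) ≡ m
    ρ-vm = trans (toℕ-ρ toℕ-vm) (reversePrefix-≥ ≤-refl)

    ρ-v0 : toℕ (ρ ⟨$⟩ʳ v0) ≡ c
    ρ-v0 = trans (toℕ-ρ toℕ-v0) (reversePrefix-< (s≤s z≤n))

  prefixReversal-replaces : SRepl (path n) vc vm v0 vm ρ
  prefixReversal-replaces x y = sym (replace-unique
    (λ u v → path-sym (ρ ⟨$⟩ʳ u) (ρ ⟨$⟩ʳ v))
    (trans (path-at ρ-vc ρ-vm) (dec-false (adjacent? 0 m) λ { (inj₁ ()) ; (inj₂ ()) }))
    (trans (path-at ρ-v0 ρ-vm) (dec-true (adjacent? c m) (inj₁ refl)))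
    (λ u v uv≢cm uv≢0m → trans (act-path-prefixReversal (<⇒≤ m<n) u v) (trans
      (does-⇔ (reversePrefix-adjacent (uv≢cm ∘ SamePair-toℕ toℕ-vc toℕ-vm) (uv≢0m ∘ SamePair-toℕ toℕ-v0 toℕ-vm))
              (adjacent? _ _) (adjacent? _ _))
      (sym (path≡does u v))))
    x y)

  prefixReversal-feasible : Feasible (path n) vc vm v0 vm
  prefixReversal-feasible =
    trans (path-at toℕ-vc toℕ-vm) (dec-true (adjacent? c m) (inj₁ refl)) ,
    trans (path-at toℕ-v0 toℕ-vm) (dec-false (adjacent? 0 m) λ { (inj₁ ()) ; (inj₂ ()) }) ,
    (λ v0≡vm → 0≢1+n (trans (sym toℕ-v0) (trans (cong toℕ v0≡vm) toℕ-vm))) ,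
    (ρ , λ x y → sym (prefixReversal-replaces x y))

  properPrefixReversal-∈SG : SG (path n) ρ
  properPrefixReversal-∈SG = gen (inj₂ (vc , vm , v0 , vm , prefixReversal-feasible , prefixReversal-replaces))

prefixReversal-∈SG : ∀ {n m} (m≤n : m ≤ n) → 2 ≤ m → SG (path n) (prefixReversal m≤n)
prefixReversal-∈SG {n} {m} m≤n (s≤s (s≤s _)) with m≤n⇒m<n∨m≡n m≤n
... | inj₁ m<n = subst (λ m≤n → SG (path n) (prefixReversal {n} {m} m≤n)) (≤-irrelevant (<⇒≤ m<n) m≤n) (properPrefixReversal-∈SG m<n)
... | inj₂ refl = gen (inj₁ (prefixReversal-automorphism m≤n))

module _ {n : ℕ} where

  private
    G = path (suc (suc n))
    0ᶠ 1ᶠ : Fin (suc (suc n))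
    0ᶠ = Fin.zero
    1ᶠ = Fin.suc Fin.zero

  beyond-two : {k : Fin (suc (suc n))} → k ≢ 0ᶠ → k ≢ 1ᶠ → 2 ≤ toℕ k
  beyond-two {Fin.zero} k≢0 _ = contradiction refl k≢0
  beyond-two {Fin.suc Fin.zero} _ k≢1 = contradiction refl k≢1
  beyond-two {Fin.suc (Fin.suc _)} _ _ = s≤s (s≤s z≤n)

  transpose-first-∈SG : SG G (transpose 0ᶠ 1ᶠ)
  transpose-first-∈SG = ext (transpose-unique σ refl refl σ-fixes) (prefixReversal-∈SG 2≤n ≤-refl)
    where
    2≤n : 2 ≤ suc (suc n)
    2≤n = s≤s (s≤s z≤n)
    σ = prefixReversal 2≤n
    σ-fixes : ∀ k → k ≢ 0ᶠ → k ≢ 1ᶠ → σ ⟨$⟩ʳ k ≡ k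
    σ-fixes k k≢0 k≢1 = toℕ-injective (trans (toℕ-reversePrefixᶠ 2≤n k) (reversePrefix-≥ (beyond-two k≢0 k≢1)))

  transpose-adjacent-∈SG : ∀ {i j} → suc (toℕ i) ≡ toℕ j → SG G (transpose i j)
  transpose-adjacent-∈SG {i} {j} i+1≡j =
    Gen-transpose-sym (subst₂ (λ u v → SG G (transpose u v)) σ0≡j σ1≡i
      (Gen-transpose-conj (prefixReversal-∈SG j<n (s≤s 1≤j)) transpose-first-∈SG))
    where
    j<n = toℕ<n j
    1≤j : 1 ≤ toℕ j
    1≤j = ≤-trans (s≤s z≤n) (≤-reflexive i+1≡j)
    σ = prefixReversal j<n
    σ0≡j : σ ⟨$⟩ʳ 0ᶠ ≡ j
    σ0≡j = toℕ-injective (trans (toℕ-reversePrefixᶠ j<n 0ᶠ) (reversePrefix-< (s≤s z≤n)))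
    σ1≡i : σ ⟨$⟩ʳ 1ᶠ ≡ i
    σ1≡i = toℕ-injective (trans (toℕ-reversePrefixᶠ j<n 1ᶠ)
      (trans (reversePrefix-< (s≤s 1≤j)) (cong (_∸ 2) (cong suc (sym i+1≡j)))))

  path-localAmoeba : LocalAmoeba G
  path-localAmoeba = Gen-transpositions⇒all (Gen-adjacent⇒transpositions transpose-adjacent-∈SG)

module _ {n : ℕ} (f : Fin (suc (suc n)) → ℕ) (f-injective : ∀ {x y} → f x ≡ f y → x ≡ y)
         (f-adjacent : ∀ {x y} → suc (toℕ x) ≡ toℕ y → Adjacent (f x) (f y)) where

  private
    0ᶠ 1ᶠ : Fin (suc (suc n))
    0ᶠ = Fin.zero
    1ᶠ = Fin.suc Fin.zero

  ascending-step : ∀ {x y z} → suc (toℕ x) ≡ toℕ y → suc (toℕ y) ≡ toℕ z →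
    suc (f x) ≡ f y → suc (f y) ≡ f z
  ascending-step {x} {y} {z} x+1≡y y+1≡z fx+1≡fy with f-adjacent y+1≡z
  ... | inj₁ fy+1≡fz = fy+1≡fz
  ... | inj₂ fz+1≡fy = contradiction (cong toℕ (f-injective (suc-injective (trans fx+1≡fy (sym fz+1≡fy))))) (<⇒≢ x<z)
    where
    x<z : toℕ x < toℕ z
    x<z = ≤-trans (≤-reflexive x+1≡y) (≤-trans (n≤1+n _) (≤-reflexive y+1≡z))

  module _ (first-ascending : suc (f 0ᶠ) ≡ f 1ᶠ) where

    ascending : ∀ i {x y} → toℕ x ≡ i → suc (toℕ x) ≡ toℕ y → suc (f x) ≡ f y
    ascending zero {x} {y} x≡0 x+1≡y
      rewrite toℕ-injective {i = x} {j = 0ᶠ} x≡0 | toℕ-injective {i = y} {j = 1ᶠ} (sym x+1≡y) = first-ascending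
    ascending (suc i) x≡i+1 x+1≡y with w , w≡i , w+1≡x ← predecessor x≡i+1 =
      ascending-step w+1≡x x+1≡y (ascending i w≡i w+1≡x)

    ascending-values : ∀ i {x} → toℕ x ≡ i → f x ≡ f 0ᶠ + i
    ascending-values zero x≡0 = trans (cong f (toℕ-injective x≡0)) (sym (+-identityʳ _))
    ascending-values (suc i) {x} x≡i+1 with w , w≡i , w+1≡x ← predecessor x≡i+1 = begin
      f x              ≡⟨ ascending i w≡i w+1≡x ⟨
      suc (f w)        ≡⟨ cong suc (ascending-values i w≡i) ⟩
      suc (f 0ᶠ + i)   ≡⟨ +-suc (f 0ᶠ) i ⟨
      f 0ᶠ + suc i     ∎
      where open ≡-Reasoning

    ascending⇒toℕ : (∀ x → f x < suc (suc n)) → ∀ x → f x ≡ toℕ x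
    ascending⇒toℕ f-bounded x = trans (ascending-values (toℕ x) refl) (cong (_+ toℕ x) f0≡0)
      where
      last = Fin.fromℕ (suc n)
      f0≡0 : f 0ᶠ ≡ 0
      f0≡0 = n≤0⇒n≡0 (+-cancelʳ-≤ (suc n) (f 0ᶠ) 0
        (≤-pred (subst (_< suc (suc n)) (ascending-values (suc n) (toℕ-fromℕ (suc n))) (f-bounded last))))

module _ {n : ℕ} {φ : Permutation′ (suc (suc n))} (φ-aut : Aut (path (suc (suc n))) φ) where

  private
    f : Fin (suc (suc n)) → ℕ
    f x = toℕ (φ ⟨$⟩ʳ x)

    f-injective : ∀ {x y} → f x ≡ f y → x ≡ y
    f-injective = Injection.injective (↔⇒↣ φ) ∘ toℕ-injective

    f-adjacent : ∀ {x y} → suc (toℕ x) ≡ toℕ y → Adjacent (f x) (f y)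
    f-adjacent {x} {y} x+1≡y = path-adjacent (trans (φ-aut x y) (path-adjacent⁻¹ (inj₁ x+1≡y)))

    f-bounded : ∀ x → f x < suc (suc n)
    f-bounded x = toℕ<n (φ ⟨$⟩ʳ x)

    g : Fin (suc (suc n)) → ℕ
    g x = suc n ∸ f x

    g+f : ∀ x → g x + f x ≡ suc n
    g+f x = m∸n+n≡m (≤-pred (f-bounded x))

    g-injective : ∀ {x y} → g x ≡ g y → x ≡ y
    g-injective {x} {y} = f-injective ∘ ∸-cancelˡ-≡ (≤-pred (f-bounded x)) (≤-pred (f-bounded y))

    g-mirrors-f : ∀ x y → g x + f x ≡ g y + f y
    g-mirrors-f x y = trans (g+f x) (sym (g+f y))

    g-adjacent : ∀ {x y} → suc (toℕ x) ≡ toℕ y → Adjacent (g x) (g y)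
    g-adjacent {x} {y} x+1≡y = Equivalence.from (Adjacent-mirror (g-mirrors-f x y)) (f-adjacent x+1≡y)

    g-bounded : ∀ x → g x < suc (suc n)
    g-bounded x = s≤s (m∸n≤m (suc n) (f x))

  path-automorphism : (∀ x → φ ⟨$⟩ʳ x ≡ x) ⊎ (∀ x → φ ⟨$⟩ʳ x ≡ opposite x)
  path-automorphism with f-adjacent {Fin.zero} {Fin.suc Fin.zero} refl
  ... | inj₁ f-up = inj₁ λ x → toℕ-injective (ascending⇒toℕ f f-injective f-adjacent f-up f-bounded x)
  ... | inj₂ f-down = inj₂ λ x → toℕ-injective (begin
    f x                 ≡⟨ sym (m∸[m∸n]≡n (≤-pred (f-bounded x))) ⟩
    suc n ∸ g x         ≡⟨ cong (suc n ∸_) (ascending⇒toℕ g g-injective g-adjacent g-up g-bounded x) ⟩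
    suc n ∸ toℕ x       ≡⟨ opposite-prop x ⟨
    toℕ (opposite x)    ∎)
    where
    open ≡-Reasoning
    g-up : suc (g Fin.zero) ≡ g (Fin.suc Fin.zero)
    g-up = Equivalence.from (successor-transfer (g-mirrors-f Fin.zero (Fin.suc Fin.zero))) f-down

twice-suc : ∀ c → 2 * suc c ≡ suc c + c + 1
twice-suc c = begin
  2 * suc c          ≡⟨ cong (suc c +_) (+-identityʳ (suc c)) ⟩
  suc c + suc c      ≡⟨ +-suc (suc c) c ⟩
  suc (suc c + c)    ≡⟨ +-comm 1 (suc c + c) ⟩
  suc c + c + 1      ∎
  where open ≡-Reasoning

middle⇔ : ∀ {n c} → c < n → 2 * suc c ≡ n + 1 ⇔ n ∸ suc c ≡ c
middle⇔ {n} {c} c<n = mk⇔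
  (λ mid → trans (cong (_∸ suc c) (sym (+-cancelʳ-≡ 1 (suc c + c) n (trans (sym (twice-suc c)) mid)))) (m+n∸m≡n (suc c) c))
  (λ n-c-1≡c → trans (twice-suc c) (cong (_+ 1) (trans (cong (suc c +_) (sym n-c-1≡c)) (m+[n∸m]≡n c<n))))

opposite-middle : ∀ {n} (k : Fin n) → 2 * suc (toℕ k) ≡ n + 1 → opposite k ≡ k
opposite-middle k mid = toℕ-injective (trans (opposite-prop k) (Equivalence.to (middle⇔ (toℕ<n k)) mid))

path-automorphism-fixes-middle : ∀ {n} (φ : Permutation′ (suc (suc n))) → Aut (path (suc (suc n))) φ →
  (k : Fin (suc (suc n))) → 2 * suc (toℕ k) ≡ suc (suc n) + 1 → φ ⟨$⟩ʳ k ≡ k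
path-automorphism-fixes-middle φ φ-aut k mid with path-automorphism {φ = φ} φ-aut
... | inj₁ φ≡id = φ≡id k
... | inj₂ φ≡opposite = trans (φ≡opposite k) (opposite-middle k mid)

path-rootSimilar : ∀ {n} (k : Fin n) → 2 * suc (toℕ k) ≢ n + 1 → ∃ λ j → RootSimilar (path n) k j
path-rootSimilar {n} k not-middle = ρ ⟨$⟩ʳ k , ρk≢k , ρ , prefixReversal-automorphism ≤-refl , refl
  where
  ρ = prefixReversal (≤-refl {n})
  ρk≢k : ρ ⟨$⟩ʳ k ≢ k
  ρk≢k ρk≡k = not-middle (Equivalence.from (middle⇔ (toℕ<n k))
    (trans (sym (reversePrefix-< (toℕ<n k))) (trans (sym (toℕ-reversePrefixᶠ ≤-refl k)) (cong toℕ ρk≡k))))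

parity⇔not-middle : ∀ n c → (n % 2 ≡ 0 ⊎ (n % 2 ≡ 1 × 2 * suc c ≢ n + 1)) ⇔ 2 * suc c ≢ n + 1
parity⇔not-middle n c = mk⇔ to from
  where
  to : n % 2 ≡ 0 ⊎ (n % 2 ≡ 1 × 2 * suc c ≢ n + 1) → 2 * suc c ≢ n + 1
  to (inj₂ (_ , not-middle)) = not-middle
  to (inj₁ n-even) mid = 0≢1+n (begin
    0                     ≡⟨ m*n%n≡0 (suc c) 2 ⟨
    suc c * 2 % 2         ≡⟨ cong (_% 2) (trans (*-comm (suc c) 2) mid) ⟩
    (n + 1) % 2           ≡⟨ %-distribˡ-+ n 1 2 ⟩
    (n % 2 + 1 % 2) % 2   ≡⟨ cong (λ r → (r + 1) % 2) n-even ⟩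
    1                     ∎)
    where open ≡-Reasoning
  from : 2 * suc c ≢ n + 1 → n % 2 ≡ 0 ⊎ (n % 2 ≡ 1 × 2 * suc c ≢ n + 1)
  from not-middle with n % 2 | m%n<n n 2
  ... | 0 | _ = inj₁ refl
  ... | 1 | _ = inj₂ (refl , not-middle)
  ... | suc (suc _) | s≤s (s≤s ())

proposition3p3 : (n : ℕ) → n ≥ 2 → (k : Fin n) →
    DoubleRootedLocalAmoeba (path n) k ⇔
      (n % 2 ≡ 0 ⊎ (n % 2 ≡ 1 × 2 * suc (toℕ k) ≢ n + 1))
proposition3p3 1 (s≤s ()) _
proposition3p3 (suc (suc n)) _ k = mk⇔
  (λ ((_ , _ , j , j≢k , φ , φ-aut , φk≡j) , _) →
    from parity (λ mid → j≢k (trans (sym φk≡j) (path-automorphism-fixes-middle φ φ-aut k mid))))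
  (λ not-middle →
    (path-minDegreeOne , LocalAmoeba⇒StemTransitive path-localAmoeba k , path-rootSimilar k (to parity not-middle)) ,
    path-localAmoeba)
  where
  open Equivalence
  parity = parity⇔not-middle (suc (suc n)) (toℕ k)
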